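{- Let $G$ be a finite simple graph without isolated vertices with minimum degree $\delta(G)=2$ and maximum degree $\Delta(G)$. Then $C_{tr}(G)\le 2\Delta(G)$.
   Context: A set $S\subseteq V$ is a total restrained dominating set (TRD-set) of $G=(V,E)$ if every vertex of $V\setminus S$ is adjacent to at least one vertex of $S$ and to at least one other vertex of $V\setminus S$, and every vertex of $S$ is adjacent to at least one other vertex of $S$. Two disjoint sets $X,Y\subseteq V$ form a total restrained coalition if neither is a TRD-set but $X\cup Y$ is a TRD-set. A trc-partition of $G$ is a partition $\Phi$ of $V$ such that no member of $\Phi$ is a TRD-set and each member forms a total restrained coalition with some other member of $\Phi$. $C_{tr}(G)$ is the maximum cardinality of a trc-partition of $G$. -}

module Defs where

open import Data.Nat using (ℕ; _≤_; _⊔_)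
open import Data.Bool using (Bool; true; false; _∨_)
open import Data.Fin using (Fin; _≟_)
open import Data.List using (List; length; filterᵇ; map; foldr)
open import Data.List using () renaming (allFin to allFinL)
open import Data.Product using (_×_; ∃; ∃-syntax; _,_)
open import Relation.Nullary using (¬_)
open import Relation.Nullary.Decidable using (⌊_⌋)
open import Relation.Binary.PropositionalEquality using (_≡_; _≢_)

record Graph (n : ℕ) : Set where
  field
    adj    : Fin n → Fin n → Bool
    sym    : ∀ u v → adj u v ≡ adj v u
    irrefl : ∀ v → adj v v ≡ false
open Graph public

Adj : ∀ {n} → Graph n → Fin n → Fin n → Set
Adj G u v = adj G u v ≡ true

degree : ∀ {n} → Graph n → Fin n → ℕ
degree {n} G v = length (filterᵇ (adj G v) (allFinL n))

-- Δ(G): maximum degree (0 for the empty graph)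
maxDegree : ∀ {n} → Graph n → ℕ
maxDegree {n} G = foldr _⊔_ 0 (map (degree G) (allFinL n))

MinDegreeIs : ∀ {n} → Graph n → ℕ → Set
MinDegreeIs G d = (∀ v → d ≤ degree G v) × (∃[ v ] degree G v ≡ d)

NoIsolated : ∀ {n} → Graph n → Set
NoIsolated G = ∀ v → ∃[ u ] Adj G v u

VSet : ℕ → Set
VSet n = Fin n → Bool

IsTRD : ∀ {n} → Graph n → VSet n → Set
IsTRD G S =
  (∀ v → S v ≡ false →
      (∃[ u ] (S u ≡ true × Adj G v u))
    × (∃[ w ] (S w ≡ false × w ≢ v × Adj G v w)))
  × (∀ v → S v ≡ true → ∃[ u ] (S u ≡ true × u ≢ v × Adj G v u))

_∪ₛ_ : ∀ {n} → VSet n → VSet n → VSet n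
(X ∪ₛ Y) v = X v ∨ Y v

TRCoalition : ∀ {n} → Graph n → VSet n → VSet n → Set
TRCoalition G X Y =
  (∀ v → X v ≡ true → Y v ≡ false) × ¬ IsTRD G X × ¬ IsTRD G Y × IsTRD G (X ∪ₛ Y)

-- A partition of V into k (nonempty) members, given by f : V → Fin k
-- surjective; member i is f⁻¹(i).
member : ∀ {n k} → (Fin n → Fin k) → Fin k → VSet n
member f i v = ⌊ f v ≟ i ⌋

IsPartition : ∀ {n k} → (Fin n → Fin k) → Set
IsPartition {n} {k} f = ∀ (i : Fin k) → ∃[ v ] f v ≡ i

IsTRCPartition : ∀ {n} → Graph n → (k : ℕ) → (Fin n → Fin k) → Set
IsTRCPartition G k f =
  IsPartition f
  × (∀ i → ¬ IsTRD G (member f i))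
  × (∀ i → ∃[ j ] (j ≢ i × TRCoalition G (member f i) (member f j)))

-- A member P that is not a TRD-set has an "escape vertex" x: every TRD-set
-- containing P must contain a neighbour of x outside P.  Now let v have the
-- two neighbours a and b, in members A and B.  The union of a coalition
-- dominates v, so every other member forms a coalition with A or B; a
-- partner of A then meets N(x_A), and a partner of B meets N(x_B).  If B also
-- meets N(x_A) and A meets N(x_B), the members are counted by
-- N(x_A) ∪ N(x_B), giving at most 2Δ of them.  If, say, B misses N(x_A), a
-- partner of B meets N(x_A) anyway, since its union with B totally
-- dominates x_A; then all members but A and B meet N(x_A), giving at most
-- Δ + 2 ≤ 2Δ, as v already witnesses Δ ≥ 2.
module Submission where

open import Defs hiding (sym)
open import Data.Nat using (ℕ; _≤_; _*_)
open import Data.Fin using (Fin)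

open import Data.Nat using (_+_; _≤?_; _⊔_)
open import Data.Nat.Properties using (≤-trans; ≰⇒>; +-mono-≤; +-identityʳ; m≤m⊔n; m≤n⊔m)
open import Data.Fin using (_≟_)
open import Data.Fin.Properties using (pigeonhole; <⇒≢; all?; any?; ¬∀⟶∃¬)
open import Data.Bool using (Bool; true; false; _∨_)
open import Data.Bool.Properties using (∨-zeroʳ; T-≡) renaming (_≟_ to _≟ᵇ_)
open import Data.List using (List; []; _∷_; length; filterᵇ; map; foldr; lookup; _++_)
open import Data.List using () renaming (allFin to allFinL)
open import Data.List.Properties using (length-++)
open import Data.List.Relation.Unary.Any as Any using (Any; here; there)
open import Data.List.Relation.Unary.Any.Properties using (lookup-result; ++⁺ˡ; ++⁺ʳ)
open import Data.List.Membership.Propositional using (_∈_)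
open import Data.List.Membership.Propositional.Properties using (∈-allFin; ∈-filter⁺)
open import Data.Product using (∃-syntax; _×_; _,_; proj₁; proj₂)
open import Data.Sum using (_⊎_; inj₁; inj₂; swap)
open import Function using (_∘_)
open import Function.Bundles using (Equivalence)
open import Relation.Nullary using (¬_; Dec; yes; no; contradiction)
open import Relation.Nullary.Decidable using (T?; toWitness; _×-dec_; _→-dec_)
open import Relation.Binary.PropositionalEquality using (_≡_; _≢_; refl; sym; trans; subst; cong)

Hits : ∀ {n k} → (Fin n → Fin k) → List (Fin n) → Fin k → Set
Hits f L i = Any (λ u → f u ≡ i) L

hitsAll⇒≤length : ∀ {n k} (f : Fin n → Fin k) (L : List (Fin n)) →
                  (∀ i → Hits f L i) → k ≤ length L
hitsAll⇒≤length {k = k} f L hits with k ≤? length L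
... | yes k≤ = k≤
... | no k≰ with pigeonhole (≰⇒> k≰) (λ i → Any.index (hits i))
... | i , j , i<j , same = contradiction i≡j (<⇒≢ i<j)
  where
  i≡j : i ≡ j
  i≡j = trans (sym (lookup-result (hits i)))
              (subst (λ p → f (lookup L p) ≡ j) (sym same) (lookup-result (hits j)))

foldr-⊔-upper : ∀ {A : Set} (g : A → ℕ) {x} (xs : List A) → x ∈ xs →
                g x ≤ foldr _⊔_ 0 (map g xs)
foldr-⊔-upper g (y ∷ ys) (here refl) = m≤m⊔n (g y) _
foldr-⊔-upper g (y ∷ ys) (there x∈) = ≤-trans (foldr-⊔-upper g ys x∈) (m≤n⊔m (g y) _)

length≡2⇒pair : ∀ {A : Set} (xs : List A) → length xs ≡ 2 →
                ∃[ a ] ∃[ b ] (∀ {u} → u ∈ xs → u ≡ a ⊎ u ≡ b)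
length≡2⇒pair (a ∷ b ∷ []) refl = a , b , λ where
  (here u≡a)         → inj₁ u≡a
  (there (here u≡b)) → inj₂ u≡b

+≤2* : ∀ {m n d} → m ≤ d → n ≤ d → m + n ≤ 2 * d
+≤2* {m} {n} {d} m≤d n≤d = subst (m + n ≤_) (cong (d +_) (sym (+-identityʳ d))) (+-mono-≤ m≤d n≤d)

∨≡true⇒ : ∀ {x y} → x ∨ y ≡ true → x ≡ true ⊎ y ≡ true
∨≡true⇒ {true}  _       = inj₁ refl
∨≡true⇒ {false} y≡true = inj₂ y≡true

_⊆ₛ_ : ∀ {n} → VSet n → VSet n → Set
X ⊆ₛ Y = ∀ v → X v ≡ true → Y v ≡ true

⊆-∪ʳ : ∀ {n} (X Y : VSet n) → Y ⊆ₛ (X ∪ₛ Y)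
⊆-∪ʳ X Y v Yv = subst (λ b → X v ∨ b ≡ true) (sym Yv) (∨-zeroʳ (X v))

module _ {n} (G : Graph n) where

  nbrs : Fin n → List (Fin n)
  nbrs x = filterᵇ (adj G x) (allFinL n)

  adj⇒∈nbrs : ∀ {x y} → Adj G x y → y ∈ nbrs x
  adj⇒∈nbrs {x} {y} xy = ∈-filter⁺ (T? ∘ adj G x) (∈-allFin y) (Equivalence.from T-≡ xy)

  degree≤maxDegree : ∀ v → degree G v ≤ maxDegree G
  degree≤maxDegree v = foldr-⊔-upper (degree G) (allFinL n) (∈-allFin v)

  adj-sym : ∀ {x y} → Adj G x y → Adj G y x
  adj-sym {x} {y} xy = trans (Graph.sym G y x) xy

  adj⇒≢ : ∀ {x y} → Adj G x y → y ≢ x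
  adj⇒≢ {x} xy refl = contradiction (trans (sym xy) (irrefl G x)) λ ()

  TRD⇒totallyDominating : ∀ {S} → IsTRD G S → ∀ u → ∃[ y ] (S y ≡ true × Adj G u y)
  TRD⇒totallyDominating {S} (outside , inside) u with S u in Su
  ... | false = proj₁ (outside u Su)
  ... | true  = let y , Sy , _ , uy = inside u Su in y , Sy , uy

  EscapesAt : VSet n → Fin n → Set
  EscapesAt P x = ∀ S → IsTRD G S → P ⊆ₛ S → ∃[ y ] (S y ≡ true × P y ≡ false × Adj G x y)

  NeighbourWith : VSet n → Bool → Fin n → Set
  NeighbourWith P b w = ∃[ y ] (P y ≡ b × Adj G w y)

  neighbourWith? : ∀ P b w → Dec (NeighbourWith P b w)
  neighbourWith? P b w = any? (λ y → (P y ≟ᵇ b) ×-dec (adj G w y ≟ᵇ true))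

  outsideNeighbour? : ∀ P w → Dec (P w ≡ false → NeighbourWith P false w)
  outsideNeighbour? P w = (P w ≟ᵇ false) →-dec neighbourWith? P false w

  undominated⇒escapesAt : ∀ {P w} → ¬ NeighbourWith P true w → EscapesAt P w
  undominated⇒escapesAt {P} {w} undominated S trd _ with TRD⇒totallyDominating trd w
  ... | y , Sy , wy with P y in Py
  ... | true  = contradiction (y , Py , wy) undominated
  ... | false = y , Sy , Py , wy

  -- If w ∉ P has all its neighbours in P, a TRD-superset S of P cannot leave
  -- w out (w would have no neighbour outside S), so w ∈ S ∖ P neighbours u.
  enclosed⇒escapesAt : ∀ {P w u} → P w ≡ false → ¬ NeighbourWith P false w → Adj G w u →
                       EscapesAt P u
  enclosed⇒escapesAt {P} {w} Pw enclosed wu S (outside , _) P⊆S with S w in Sw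
  ... | true  = w , Sw , Pw , adj-sym wu
  ... | false with proj₂ (outside w Sw)
  ... | z , Sz , _ , wz with P z in Pz
  ... | false = contradiction (z , Pz , wz) enclosed
  ... | true  = contradiction (trans (sym (P⊆S z Pz)) Sz) λ ()

  dominating∧open⇒TRD : ∀ {P} → (∀ w → NeighbourWith P true w) →
                        (∀ w → P w ≡ false → NeighbourWith P false w) → IsTRD G P
  dominating∧open⇒TRD dom open′ = (λ w Pw → dom w , distinct (open′ w Pw))
                                , (λ w _ → distinct (dom w))
    where
    distinct : ∀ {P b w} → NeighbourWith P b w → ∃[ y ] (P y ≡ b × y ≢ w × Adj G w y)
    distinct (y , Py , wy) = y , Py , adj⇒≢ wy , wy

  escapeVertex : NoIsolated G → ∀ {P} → ¬ IsTRD G P → ∃[ x ] EscapesAt P x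
  escapeVertex noIsolated {P} ¬trd with all? (neighbourWith? P true)
  ... | no ¬dom =
    let w , undominated = ¬∀⟶∃¬ n _ (neighbourWith? P true) ¬dom
    in w , undominated⇒escapesAt undominated
  ... | yes dom with all? (outsideNeighbour? P)
  ...   | yes open′ = contradiction (dominating∧open⇒TRD dom open′) ¬trd
  ...   | no ¬open with ¬∀⟶∃¬ n _ (outsideNeighbour? P) ¬open
  ...     | w , ¬openw with P w in Pw
  ...       | true  = contradiction (λ ()) ¬openw
  ...       | false = let u , wu = noIsolated w
                      in u , enclosed⇒escapesAt Pw (λ nb → ¬openw λ _ → nb) wu

module _ {n k} (G : Graph n) (f : Fin n → Fin k) where

  Coalesces : Fin k → Fin k → Set
  Coalesces i j = IsTRD G (member f i ∪ₛ member f j)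

  member≡true⇒ : ∀ {i y} → member f i y ≡ true → f y ≡ i
  member≡true⇒ iy = toWitness (Equivalence.from T-≡ iy)

  adj⇒hits : ∀ {x y i} → Adj G x y → f y ≡ i → Hits f (nbrs G x) i
  adj⇒hits xy fy≡i = Any.map (λ { refl → fy≡i }) (adj⇒∈nbrs G xy)

  escapesAt⇒partnerHits : ∀ {p x} → EscapesAt G (member f p) x →
                          ∀ i → Coalesces i p → Hits f (nbrs G x) i
  escapesAt⇒partnerHits {p} esc i trd with esc _ trd (⊆-∪ʳ (member f i) (member f p))
  ... | y , Sy , py≡false , xy with ∨≡true⇒ Sy
  ... | inj₁ iy = adj⇒hits xy (member≡true⇒ iy)
  ... | inj₂ py = contradiction (trans (sym py) py≡false) λ ()

  missed⇒partnerHits : ∀ {q x} → ¬ Hits f (nbrs G x) q →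
                       ∀ i → Coalesces i q → Hits f (nbrs G x) i
  missed⇒partnerHits {x = x} missed i trd with TRD⇒totallyDominating G trd x
  ... | y , Sy , xy with ∨≡true⇒ Sy
  ... | inj₁ iy = adj⇒hits xy (member≡true⇒ iy)
  ... | inj₂ qy = contradiction (adj⇒hits xy (member≡true⇒ qy)) missed

  module _ (coalition : ∀ i → ∃[ j ] (j ≢ i × TRCoalition G (member f i) (member f j))) where

    module Degree2 {v a b} (N[v]⊆ab : ∀ {u} → Adj G v u → u ≡ a ⊎ u ≡ b) where

      partner : ∀ i → i ≢ f a → i ≢ f b →
                Coalesces i (f a) ⊎ Coalesces i (f b)
      partner i i≢A i≢B with coalition i
      ... | j , _ , _ , _ , _ , trd with TRD⇒totallyDominating G trd v
      ... | y , Sy , vy with N[v]⊆ab vy | ∨≡true⇒ Sy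
      ... | inj₁ refl | inj₁ iy = contradiction (sym (member≡true⇒ iy)) i≢A
      ... | inj₂ refl | inj₁ iy = contradiction (sym (member≡true⇒ iy)) i≢B
      ... | inj₁ refl | inj₂ jy = inj₁ (subst (Coalesces i) (sym (member≡true⇒ jy)) trd)
      ... | inj₂ refl | inj₂ jy = inj₂ (subst (Coalesces i) (sym (member≡true⇒ jy)) trd)

      ≤2+degree : ∀ {xA} → EscapesAt G (member f (f a)) xA → ¬ Hits f (nbrs G xA) (f b) →
                  k ≤ 2 + degree G xA
      ≤2+degree {xA} escA missedB = hitsAll⇒≤length f (a ∷ b ∷ nbrs G xA) hits
        where
        hits : ∀ i → Hits f (a ∷ b ∷ nbrs G xA) i
        hits i with f a ≟ i | f b ≟ i
        ... | yes A≡i | _        = here A≡i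
        ... | no _    | yes B≡i = there (here B≡i)
        ... | no A≢i  | no B≢i with partner i (A≢i ∘ sym) (B≢i ∘ sym)
        ... | inj₁ trd = there (there (escapesAt⇒partnerHits escA i trd))
        ... | inj₂ trd = there (there (missed⇒partnerHits missedB i trd))

      ≤degree+degree : ∀ {xA xB} →
                       EscapesAt G (member f (f a)) xA → EscapesAt G (member f (f b)) xB →
                       Hits f (nbrs G xA) (f b) → Hits f (nbrs G xB) (f a) →
                       k ≤ degree G xA + degree G xB
      ≤degree+degree {xA} {xB} escA escB hitB hitA =
        subst (k ≤_) (length-++ (nbrs G xA)) (hitsAll⇒≤length f (nbrs G xA ++ nbrs G xB) hits)
        where
        hits : ∀ i → Hits f (nbrs G xA ++ nbrs G xB) i
        hits i with f a ≟ i | f b ≟ i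
        ... | yes refl | _        = ++⁺ʳ (nbrs G xA) hitA
        ... | no _     | yes refl = ++⁺ˡ hitB
        ... | no A≢i   | no B≢i with partner i (A≢i ∘ sym) (B≢i ∘ sym)
        ... | inj₁ trd = ++⁺ˡ (escapesAt⇒partnerHits escA i trd)
        ... | inj₂ trd = ++⁺ʳ (nbrs G xA) (escapesAt⇒partnerHits escB i trd)

    ≤2Δ-at-degree-2 : ∀ {v a b} → (∀ {u} → Adj G v u → u ≡ a ⊎ u ≡ b) → 2 ≤ maxDegree G →
                      ∀ {xA xB} →
                      EscapesAt G (member f (f a)) xA → EscapesAt G (member f (f b)) xB →
                      k ≤ 2 * maxDegree G
    ≤2Δ-at-degree-2 {a = a} {b} N[v]⊆ab Δ≥2 {xA} {xB} escA escB
      with Any.any? (λ u → f u ≟ f b) (nbrs G xA) | Any.any? (λ u → f u ≟ f a) (nbrs G xB)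
    ... | no missedB | _ =
      ≤-trans (Degree2.≤2+degree N[v]⊆ab escA missedB) (+≤2* Δ≥2 (degree≤maxDegree G xA))
    ... | yes _ | no missedA =
      ≤-trans (Degree2.≤2+degree (swap ∘ N[v]⊆ab) escB missedA) (+≤2* Δ≥2 (degree≤maxDegree G xB))
    ... | yes hitB | yes hitA =
      ≤-trans (Degree2.≤degree+degree N[v]⊆ab escA escB hitB hitA)
              (+≤2* (degree≤maxDegree G xA) (degree≤maxDegree G xB))

theorem2p13 : ∀ (n : ℕ) (G : Graph n) → NoIsolated G → MinDegreeIs G 2 →
    ∀ (k : ℕ) (f : Fin n → Fin k) → IsTRCPartition G k f →
    k ≤ 2 * maxDegree G
theorem2p13 n G noIsolated (_ , v , degv≡2) k f (_ , notTRD , coalition)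
  with length≡2⇒pair (nbrs G v) degv≡2
... | a , b , N[v]⊆ab =
  ≤2Δ-at-degree-2 G f coalition (N[v]⊆ab ∘ adj⇒∈nbrs G) Δ≥2
    (proj₂ (escapeVertex G noIsolated (notTRD (f a))))
    (proj₂ (escapeVertex G noIsolated (notTRD (f b))))
  where
  Δ≥2 : 2 ≤ maxDegree G
  Δ≥2 = subst (_≤ maxDegree G) degv≡2 (degree≤maxDegree G v)
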